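{- Let $r\ge3$ and consider the Lie algebra of type $A_r$ with simple roots $\alpha_1,\dots,\alpha_r$. If $I\subset\{2,\ldots,r-1\}$ is a set of pairwise nonconsecutive integers and $\beta=\sum_{i=1}^r\alpha_i+\sum_{i\in I}\alpha_i$, then $$\wp_q(\beta)=q^{|I|+1}(1+q)^{r-1-2|I|}(2+2q+q^2)^{|I|}.$$
   Context: In type $A_r$ the positive roots are $\alpha_i+\alpha_{i+1}+\cdots+\alpha_j$ for $1\le i\le j\le r$. A decomposition of a weight $\xi$ is a function $n:\Phi^+\to\mathbb{Z}_{\ge0}$ with $\sum_\alpha n(\alpha)\alpha=\xi$, using $\sum_\alpha n(\alpha)$ positive roots. The $q$-analog of Kostant's partition function is $\wp_q(\xi)=\sum_k c_kq^k$ where $c_k$ is the number of decompositions of $\xi$ using exactly $k$ positive roots. -}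

module Defs where

open import Data.Nat using (ℕ; zero; suc; _+_; _*_; _≤_; _≤?_)
open import Data.Bool using (Bool; true; false; if_then_else_)
open import Data.Product using (_×_; _,_; proj₁; proj₂; Σ)
open import Data.Fin using (Fin; toℕ)
open import Data.List using (List; []; _∷_; length; filter; cartesianProduct; allFin)
open import Data.Vec using (Vec; []; _∷_; tabulate; zipWith; replicate; lookup)
open import Data.Fin.Subset using (Subset)
open import Relation.Nullary.Decidable using (⌊_⌋; _×-dec_)
open import Relation.Binary.PropositionalEquality using (_≡_)

-- Type A_r, simple roots α_0 … α_{r-1} (0-based indices: paper's α_{m+1} is index m).
-- A weight ξ = Σ_m ξ_m α_m with ξ_m ∈ ℕ is represented by its coefficient vector.
Weight : ℕ → Set
Weight r = Vec ℕ r

-- Positive root α_i + … + α_j (i ≤ j) is encoded as the pair (i , j).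
PosRootIdx : ℕ → Set
PosRootIdx r = Fin r × Fin r

posRoots : (r : ℕ) → List (PosRootIdx r)
posRoots r = filter (λ p → toℕ (proj₁ p) ≤? toℕ (proj₂ p))
                    (cartesianProduct (allFin r) (allFin r))

rootVec : ∀ {r} → PosRootIdx r → Weight r
rootVec (i , j) = tabulate λ m →
  if ⌊ (toℕ i ≤? toℕ m) ×-dec (toℕ m ≤? toℕ j) ⌋ then 1 else 0

combo : ∀ {r} (ρ : List (PosRootIdx r)) → Vec ℕ (length ρ) → Weight r
combo {r} []      []       = replicate r 0
combo     (α ∷ ρ) (c ∷ cs) = zipWith _+_ (Data.Vec.map (c *_) (rootVec α)) (combo ρ cs)

vsum : ∀ {n} → Vec ℕ n → ℕ
vsum []       = 0
vsum (x ∷ xs) = x + vsum xs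

-- Decompositions n : Φ⁺ → ℕ of ξ using exactly k positive roots
-- (n is stored as the vector of its values along posRoots r).
DecompUsing : (r : ℕ) → Weight r → ℕ → Set
DecompUsing r ξ k =
  Σ (Vec ℕ (length (posRoots r))) λ n → (combo (posRoots r) n ≡ ξ) × (vsum n ≡ k)

-- Polynomials in q with ℕ coefficients: coefficient lists, constant term first.
Poly : Set
Poly = List ℕ

_+P_ : Poly → Poly → Poly
[]       +P q        = q
(a ∷ p)  +P []       = a ∷ p
(a ∷ p)  +P (b ∷ q)  = (a + b) ∷ (p +P q)

scaleP : ℕ → Poly → Poly
scaleP c []      = []
scaleP c (a ∷ p) = (c * a) ∷ scaleP c p

_*P_ : Poly → Poly → Poly
[]      *P q = []
(a ∷ p) *P q = scaleP a q +P (0 ∷ (p *P q))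

_^P_ : Poly → ℕ → Poly
p ^P zero  = 1 ∷ []
p ^P suc n = p *P (p ^P n)

qP : Poly
qP = 0 ∷ 1 ∷ []

coeff : Poly → ℕ → ℕ
coeff []      _       = 0
coeff (a ∷ p) zero    = a
coeff (a ∷ p) (suc k) = coeff p k

betaI : ∀ {r} → Subset r → Weight r
betaI I = tabulate λ m → if lookup I m then 2 else 1

-- The identity is proved bijectively, coefficient by coefficient.  A graded set
-- X : ℕ → Set stands for the series Σ_k |X k| qᵏ; sums, products and the shift by q
-- become ⊎, a Cauchy product ⋆ and q·, and a polynomial p becomes ⟦ p ⟧.
--
-- A decomposition into positive roots (intervals [i,j]) is built by scanning the
-- positions from left to right, remembering the intervals that are still open.
-- `Carried r inc ξ` counts decompositions of ξ given carried-in intervals inc; with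
-- nothing carried it is ℘_q(ξ) (DecompUsing↔D₀).  Writing D₀/D₁ for "nothing / one
-- interval carried" and D = D₀ ⊕ D₁, a look at one or two positions gives
--   D (1 ∷ ξ) ≅ (1+q) · D ξ    and    D (2 ∷ 1 ∷ ξ) ≅ q(2+2q+q²) · D ξ.
-- Under the hypotheses β = 1 ∷ β_J where J is a word in the blocks 1 and 2,1
-- (`Blocks`), so ℘_q(β) = q · D(β_J) is the stated product.

module Submission where

open import Defs
open import Level using (0ℓ) renaming (suc to lsuc)
open import Data.Nat using (ℕ; zero; suc; _+_; _*_; _∸_; _≤_; _<_; z≤n; s≤s; _≤?_; _≤ᵇ_)
open import Data.Nat.Properties
  using (+-commutativeSemigroup; +-comm; +-assoc; +-identityʳ; *-zeroʳ; *-identityʳ; *-suc; +-suc; ≡-irrelevant; m+n∸n≡m; m≤m+n; <⇒≱; ≤-pred)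
open import Algebra.Properties.CommutativeSemigroup +-commutativeSemigroup
  using () renaming (interchange to +-interchange)
open import Data.Fin using (Fin; zero; suc; toℕ)
open import Data.Fin.Properties using (+↔⊎; *↔×; 0↔⊥)
open import Data.Fin.Subset using (Subset; _∈_; ∣_∣)
open import Data.Bool using (Bool; true; false; if_then_else_; _∧_)
open import Data.Product using (Σ; _×_; _,_; proj₁; proj₂)
open import Data.Product.Algebra using (×-cong)
open import Data.Product.Function.Dependent.Propositional using (Σ-↔)
open import Data.Sum using (_⊎_; inj₁; inj₂)
open import Data.Sum.Algebra using (⊎-cong; ⊎-comm; ⊎-assoc)
open import Data.Empty using (⊥; ⊥-elim)
open import Data.List using (List; []; _∷_; map; filter; _++_; length; cartesianProduct; allFin)
import Data.List as List
open import Data.List.Properties using (filter-++; map-++; map-tabulate; map-∘)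
open import Data.Vec using (Vec; []; _∷_; replicate; zipWith; tabulate)
import Data.Vec as Vec
open import Data.Vec.Properties using (tabulate-cong; lookup⇒[]=)
open import Function using (_∘_)
open import Function.Bundles using (_↔_; mk↔ₛ′; Inverse)
open import Function.Properties.Inverse using (↔-refl; ↔-sym; ↔-trans)
open import Function.Related.Propositional using (module EquationalReasoning)
open import Relation.Binary.Bundles using (Setoid)
import Relation.Binary.Reasoning.Setoid as SetoidReasoning
open import Relation.Binary.PropositionalEquality
  using (_≡_; _≢_; refl; sym; trans; cong; cong₂; subst; module ≡-Reasoning)
open import Relation.Nullary using (¬_)
open import Relation.Nullary.Decidable using (does; isYes; isYes≗does; _×-dec_)
open import Relation.Unary using (Decidable)

private variable
  A B : Set

≡⇒↔ : A ≡ B → A ↔ B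
≡⇒↔ refl = ↔-refl

empty↔empty : ¬ A → ¬ B → A ↔ B
empty↔empty ¬a ¬b = mk↔ₛ′ (⊥-elim ∘ ¬a) (⊥-elim ∘ ¬b) (⊥-elim ∘ ¬b) (⊥-elim ∘ ¬a)

drop-emptyʳ : ¬ B → (A ⊎ B) ↔ A
drop-emptyʳ ¬b = mk↔ₛ′ (λ { (inj₁ a) → a ; (inj₂ b) → ⊥-elim (¬b b) }) inj₁
  (λ _ → refl) (λ { (inj₁ a) → refl ; (inj₂ b) → ⊥-elim (¬b b) })

drop-emptyˡ : ¬ A → (A ⊎ B) ↔ B
drop-emptyˡ ¬a = ↔-trans (⊎-comm _ _) (drop-emptyʳ ¬a)

Σ-congʳ : {I : Set} {P Q : I → Set} → (∀ i → P i ↔ Q i) → Σ I P ↔ Σ I Q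
Σ-congʳ e = Σ-↔ ↔-refl (e _)

Σℕ-split : {F : ℕ → Set} → Σ ℕ F ↔ (F 0 ⊎ Σ ℕ (F ∘ suc))
Σℕ-split = mk↔ₛ′ (λ { (zero , x) → inj₁ x ; (suc n , x) → inj₂ (n , x) })
                 (λ { (inj₁ x) → zero , x ; (inj₂ (n , x)) → suc n , x })
                 (λ { (inj₁ x) → refl ; (inj₂ (n , x)) → refl })
                 (λ { (zero , x) → refl ; (suc n , x) → refl })

ΣFin-split : ∀ {n} {F : Fin (suc n) → Set} → Σ (Fin (suc n)) F ↔ (F zero ⊎ Σ (Fin n) (F ∘ suc))
ΣFin-split = mk↔ₛ′ (λ { (zero , x) → inj₁ x ; (suc j , x) → inj₂ (j , x) })
                   (λ { (inj₁ x) → zero , x ; (inj₂ (j , x)) → suc j , x })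
                   (λ { (inj₁ x) → refl ; (inj₂ (j , x)) → refl })
                   (λ { (zero , x) → refl ; (suc j , x) → refl })

ΣVec-split : ∀ {n} {F : Vec ℕ (suc n) → Set} →
             Σ (Vec ℕ (suc n)) F ↔ Σ ℕ (λ x → Σ (Vec ℕ n) λ v → F (x ∷ v))
ΣVec-split = mk↔ₛ′ (λ { (x ∷ v , p) → x , v , p }) (λ (x , v , p) → x ∷ v , p)
                   (λ _ → refl) (λ { (x ∷ v , p) → refl })

Σ-empty : {I : Set} {F : I → Set} → (∀ i → ¬ F i) → ¬ Σ I F
Σ-empty h (i , x) = h i x

suc≡suc↔ : {a b : ℕ} → (suc a ≡ suc b) ↔ (a ≡ b)
suc≡suc↔ = mk↔ₛ′ (λ { refl → refl }) (λ { refl → refl }) (λ { refl → refl }) (λ { refl → refl })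

∷≡∷↔ : ∀ {n} {a b : ℕ} {u w : Vec ℕ n} → (a ∷ u ≡ b ∷ w) ↔ ((a ≡ b) × (u ≡ w))
∷≡∷↔ = mk↔ₛ′ (λ { refl → refl , refl }) (λ { (refl , refl) → refl })
             (λ { (refl , refl) → refl }) (λ { refl → refl })

transport× : {a m : ℕ} {Q : ℕ → Set} → ((a ≡ m) × Q a) ↔ ((a ≡ m) × Q m)
transport× = mk↔ₛ′ (λ { (refl , q) → refl , q }) (λ { (refl , q) → refl , q })
                   (λ { (refl , q) → refl }) (λ { (refl , q) → refl })

-- A graded set X stands for the series Σ_k |X k| q^k; a graded bijection
-- X ≅ Y is a proof that two series are equal, coefficient by coefficient.

GradedSet : Set₁
GradedSet = ℕ → Set

infix 1 _≅_
_≅_ : GradedSet → GradedSet → Set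
X ≅ Y = ∀ k → X k ↔ Y k

≅-setoid : Setoid (lsuc 0ℓ) 0ℓ
≅-setoid = record
  { Carrier       = GradedSet
  ; _≈_           = _≅_
  ; isEquivalence = record
    { refl  = λ k → ↔-refl
    ; sym   = λ e k → ↔-sym (e k)
    ; trans = λ e f k → ↔-trans (e k) (f k)
    }
  }

open Setoid ≅-setoid public using () renaming (refl to ≅-refl; sym to ≅-sym; trans to ≅-trans)
module ≅-Reasoning = SetoidReasoning ≅-setoid

infixr 5 _⊕_
_⊕_ : GradedSet → GradedSet → GradedSet
(X ⊕ Y) k = X k ⊎ Y k

infixr 6 _⋆_
_⋆_ : GradedSet → GradedSet → GradedSet
(X ⋆ Y) k = Σ ℕ λ a → Σ ℕ λ b → (a + b ≡ k) × (X a × Y b)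

q·_ : GradedSet → GradedSet
(q· X) zero    = ⊥
(q· X) (suc k) = X k

q^_·_ : ℕ → GradedSet → GradedSet
q^ zero  · X = X
q^ suc s · X = q· (q^ s · X)

⟦_⟧ : Poly → GradedSet
⟦ p ⟧ k = Fin (coeff p k)

⊕-cong : {X X′ Y Y′ : GradedSet} → X ≅ X′ → Y ≅ Y′ → (X ⊕ Y) ≅ (X′ ⊕ Y′)
⊕-cong e f k = ⊎-cong (e k) (f k)

⊕-comm : {X Y : GradedSet} → (X ⊕ Y) ≅ (Y ⊕ X)
⊕-comm k = ⊎-comm _ _

q·-cong : {X Y : GradedSet} → X ≅ Y → (q· X) ≅ (q· Y)
q·-cong e zero    = ↔-refl
q·-cong e (suc k) = e k

q^-cong : ∀ s {X Y : GradedSet} → X ≅ Y → (q^ s · X) ≅ (q^ s · Y)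
q^-cong zero    e = e
q^-cong (suc s) e = q·-cong (q^-cong s e)

q·-⊕ : {X Y : GradedSet} → (q· (X ⊕ Y)) ≅ (q· X ⊕ q· Y)
q·-⊕ zero    = empty↔empty (λ ()) λ { (inj₁ ()) ; (inj₂ ()) }
q·-⊕ (suc k) = ↔-refl

q·-Σ : {I : Set} {F : I → GradedSet} → (λ k → Σ I λ i → (q· F i) k) ≅ q· (λ k → Σ I λ i → F i k)
q·-Σ zero    = empty↔empty (Σ-empty λ i ()) (λ ())
q·-Σ (suc k) = ↔-refl

q^-⊕ : ∀ s {X Y : GradedSet} → (q^ s · (X ⊕ Y)) ≅ (q^ s · X ⊕ q^ s · Y)
q^-⊕ zero    = ≅-refl
q^-⊕ (suc s) = ≅-trans (q·-cong (q^-⊕ s)) q·-⊕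

q^-Σ : ∀ s {I : Set} {F : I → GradedSet} →
       (λ k → Σ I λ i → (q^ s · F i) k) ≅ q^ s · (λ k → Σ I λ i → F i k)
q^-Σ zero    = ≅-refl
q^-Σ (suc s) = ≅-trans q·-Σ (q·-cong (q^-Σ s))

q^-empty : ∀ s {X : GradedSet} → (∀ k → ¬ X k) → ∀ k → ¬ (q^ s · X) k
q^-empty zero    h k       x = h k x
q^-empty (suc s) h (suc k) x = q^-empty s h k x

q^-shift : ∀ s {N : Set} (E : N → Set) (deg : N → ℕ) →
           (λ k → Σ N λ n → E n × (s + deg n ≡ k)) ≅ q^ s · (λ k → Σ N λ n → E n × (deg n ≡ k))
q^-shift zero    E deg k       = ↔-refl
q^-shift (suc s) E deg zero    = empty↔empty (λ { (n , _ , ()) }) (λ ())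
q^-shift (suc s) E deg (suc k) = ↔-trans (Σ-congʳ λ n → ×-cong ↔-refl suc≡suc↔) (q^-shift s E deg k)

⋆-cong : {X X′ Y Y′ : GradedSet} → X ≅ X′ → Y ≅ Y′ → (X ⋆ Y) ≅ (X′ ⋆ Y′)
⋆-cong e f k = Σ-congʳ λ a → Σ-congʳ λ b → ×-cong ↔-refl (×-cong (e a) (f b))

⋆-comm : {X Y : GradedSet} → (X ⋆ Y) ≅ (Y ⋆ X)
⋆-comm k = mk↔ₛ′ swap swap swap² swap²
  where
  swap : ∀ {X Y} → (X ⋆ Y) k → (Y ⋆ X) k
  swap (a , b , p , x , y) = b , a , trans (+-comm b a) p , y , x
  swap² : ∀ {X Y} (z : (X ⋆ Y) k) → swap (swap z) ≡ z
  swap² (a , b , p , x , y) = cong (λ e → a , b , e , x , y) (≡-irrelevant _ _)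

⋆-assoc : {X Y W : GradedSet} → ((X ⋆ Y) ⋆ W) ≅ (X ⋆ (Y ⋆ W))
⋆-assoc {X} {Y} {W} k = mk↔ₛ′ to from to∘from from∘to
  where
  to : ((X ⋆ Y) ⋆ W) k → (X ⋆ (Y ⋆ W)) k
  to (_ , c , p , (a , b , refl , x , y) , w) =
    a , b + c , trans (sym (+-assoc a b c)) p , x , (b , c , refl , y , w)
  from : (X ⋆ (Y ⋆ W)) k → ((X ⋆ Y) ⋆ W) k
  from (a , _ , p , x , (b , c , refl , y , w)) =
    a + b , c , trans (+-assoc a b c) p , (a , b , refl , x , y) , w
  to∘from : ∀ z → to (from z) ≡ z
  to∘from (a , _ , p , x , (b , c , refl , y , w)) =
    cong (λ e → a , b + c , e , x , (b , c , refl , y , w)) (≡-irrelevant _ _)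
  from∘to : ∀ z → from (to z) ≡ z
  from∘to (_ , c , p , (a , b , refl , x , y) , w) =
    cong (λ e → a + b , c , e , (a , b , refl , x , y) , w) (≡-irrelevant _ _)

⋆-left-comm : {X Y W : GradedSet} → (X ⋆ (Y ⋆ W)) ≅ (Y ⋆ (X ⋆ W))
⋆-left-comm {X} {Y} {W} =
  ≅-trans (≅-sym (⋆-assoc {X})) (≅-trans (⋆-cong (⋆-comm {X}) (≅-refl {W})) (⋆-assoc {Y}))

⋆-interchange : {P Q X Y : GradedSet} → ((P ⋆ Q) ⋆ (X ⋆ Y)) ≅ ((P ⋆ X) ⋆ (Q ⋆ Y))
⋆-interchange {P} {Q} {X} {Y} = begin
  (P ⋆ Q) ⋆ (X ⋆ Y) ≈⟨ ⋆-assoc {P} ⟩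
  P ⋆ (Q ⋆ (X ⋆ Y)) ≈⟨ ⋆-cong (≅-refl {P}) (≅-sym (⋆-assoc {Q})) ⟩
  P ⋆ ((Q ⋆ X) ⋆ Y) ≈⟨ ⋆-cong (≅-refl {P}) (⋆-cong (⋆-comm {Q}) (≅-refl {Y})) ⟩
  P ⋆ ((X ⋆ Q) ⋆ Y) ≈⟨ ⋆-cong (≅-refl {P}) (⋆-assoc {X}) ⟩
  P ⋆ (X ⋆ (Q ⋆ Y)) ≈⟨ ≅-sym (⋆-assoc {P}) ⟩
  (P ⋆ X) ⋆ (Q ⋆ Y) ∎
  where open ≅-Reasoning

⋆-unfold : {X Y : GradedSet} → (X ⋆ Y) ≅ ((λ k → X 0 × Y k) ⊕ q· ((X ∘ suc) ⋆ Y))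
⋆-unfold {X} {Y} k = mk↔ₛ′ (to k) (from k) (to∘from k) (from∘to k)
  where
  to : ∀ k → (X ⋆ Y) k → ((λ k → X 0 × Y k) ⊕ q· ((X ∘ suc) ⋆ Y)) k
  to k       (zero  , b , refl , x , y) = inj₁ (x , y)
  to (suc k) (suc a , b , p    , x , y) = inj₂ (a , b , Inverse.to suc≡suc↔ p , x , y)
  from : ∀ k → ((λ k → X 0 × Y k) ⊕ q· ((X ∘ suc) ⋆ Y)) k → (X ⋆ Y) k
  from k       (inj₁ (x , y))              = zero , k , refl , x , y
  from (suc k) (inj₂ (a , b , p , x , y)) = suc a , b , cong suc p , x , y
  to∘from : ∀ k z → to k (from k z) ≡ z
  to∘from k       (inj₁ (x , y))                 = refl
  to∘from (suc k) (inj₂ (a , b , refl , x , y)) = refl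
  from∘to : ∀ k z → from k (to k z) ≡ z
  from∘to k       (zero  , b , refl , x , y) = refl
  from∘to (suc k) (suc a , b , refl , x , y) = refl

coeff-+P : ∀ p p′ k → coeff (p +P p′) k ≡ coeff p k + coeff p′ k
coeff-+P []      p′       k       = refl
coeff-+P (a ∷ p) []       k       = sym (+-identityʳ _)
coeff-+P (a ∷ p) (b ∷ p′) zero    = refl
coeff-+P (a ∷ p) (b ∷ p′) (suc k) = coeff-+P p p′ k

coeff-scaleP : ∀ c p k → coeff (scaleP c p) k ≡ c * coeff p k
coeff-scaleP c []      k       = sym (*-zeroʳ c)
coeff-scaleP c (a ∷ p) zero    = refl
coeff-scaleP c (a ∷ p) (suc k) = coeff-scaleP c p k

⟦0∷⟧ : ∀ p → ⟦ 0 ∷ p ⟧ ≅ q· ⟦ p ⟧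
⟦0∷⟧ p zero    = 0↔⊥
⟦0∷⟧ p (suc k) = ↔-refl

-- Polynomial multiplication is the product of graded sets (induction on p,
-- matching the recursion p = a + q·p′ of _*P_ with ⋆-unfold).
⟦⟧-*P : ∀ p p′ → ⟦ p *P p′ ⟧ ≅ (⟦ p ⟧ ⋆ ⟦ p′ ⟧)
⟦⟧-*P []      p′ k = empty↔empty (λ ()) (λ { (_ , _ , _ , () , _) })
⟦⟧-*P (a ∷ p) p′ k = begin
  Fin (coeff (scaleP a p′ +P (0 ∷ (p *P p′))) k)
    ↔⟨ ≡⇒↔ (cong Fin (trans (coeff-+P (scaleP a p′) _ k) (cong (_+ _) (coeff-scaleP a p′ k)))) ⟩
  Fin (a * coeff p′ k + coeff (0 ∷ (p *P p′)) k)
    ↔⟨ +↔⊎ ⟩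
  (Fin (a * coeff p′ k) ⊎ ⟦ 0 ∷ (p *P p′) ⟧ k)
    ↔⟨ ⊎-cong *↔× (↔-trans (⟦0∷⟧ (p *P p′) k) (q·-cong (⟦⟧-*P p p′) k)) ⟩
  ((Fin a × ⟦ p′ ⟧ k) ⊎ (q· (⟦ p ⟧ ⋆ ⟦ p′ ⟧)) k)
    ↔⟨ ↔-sym (⋆-unfold {⟦ a ∷ p ⟧} {⟦ p′ ⟧} k) ⟩
  (⟦ a ∷ p ⟧ ⋆ ⟦ p′ ⟧) k ∎
  where open EquationalReasoning

Fin0×-empty : ¬ (Fin 0 × A)
Fin0×-empty (() , _)

Fin1×↔ : (Fin 1 × A) ↔ A
Fin1×↔ = mk↔ₛ′ proj₂ (zero ,_) (λ _ → refl) (λ { (zero , a) → refl })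

Fin2×↔ : (Fin 2 × A) ↔ (A ⊎ A)
Fin2×↔ = mk↔ₛ′ (λ { (zero , a) → inj₁ a ; (suc zero , a) → inj₂ a })
               (λ { (inj₁ a) → zero , a ; (inj₂ a) → suc zero , a })
               (λ { (inj₁ a) → refl ; (inj₂ a) → refl })
               (λ { (zero , a) → refl ; (suc zero , a) → refl })

⟦[]⟧-⋆-empty : {X : GradedSet} → ∀ k → ¬ (⟦ [] ⟧ ⋆ X) k
⟦[]⟧-⋆-empty k (_ , _ , _ , () , _)

⟦0∷⟧-⋆ : ∀ p {X : GradedSet} → (⟦ 0 ∷ p ⟧ ⋆ X) ≅ q· (⟦ p ⟧ ⋆ X)
⟦0∷⟧-⋆ p {X} k = ↔-trans (⋆-unfold {⟦ 0 ∷ p ⟧} {X} k) (drop-emptyˡ Fin0×-empty)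

⟦1∷⟧-⋆ : ∀ p {X : GradedSet} → (⟦ 1 ∷ p ⟧ ⋆ X) ≅ (X ⊕ q· (⟦ p ⟧ ⋆ X))
⟦1∷⟧-⋆ p {X} k = ↔-trans (⋆-unfold {⟦ 1 ∷ p ⟧} {X} k) (⊎-cong Fin1×↔ ↔-refl)

⟦2∷⟧-⋆ : ∀ p {X : GradedSet} → (⟦ 2 ∷ p ⟧ ⋆ X) ≅ ((X ⊕ X) ⊕ q· (⟦ p ⟧ ⋆ X))
⟦2∷⟧-⋆ p {X} k = ↔-trans (⋆-unfold {⟦ 2 ∷ p ⟧} {X} k) (⊎-cong Fin2×↔ ↔-refl)

⟦1⟧-⋆ : {X : GradedSet} → (⟦ 1 ∷ [] ⟧ ⋆ X) ≅ X
⟦1⟧-⋆ {X} k = ↔-trans (⟦1∷⟧-⋆ [] k) (drop-emptyʳ (no-tail k))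
  where
  no-tail : ∀ k → ¬ (q· (⟦ [] ⟧ ⋆ X)) k
  no-tail (suc k) = ⟦[]⟧-⋆-empty k

⟦q⟧-⋆ : {X : GradedSet} → (⟦ qP ⟧ ⋆ X) ≅ q· X
⟦q⟧-⋆ = ≅-trans (⟦0∷⟧-⋆ (1 ∷ [])) (q·-cong ⟦1⟧-⋆)

⟦1+q⟧-⋆ : {X : GradedSet} → (⟦ 1 ∷ 1 ∷ [] ⟧ ⋆ X) ≅ (X ⊕ q· X)
⟦1+q⟧-⋆ = ≅-trans (⟦1∷⟧-⋆ (1 ∷ [])) (⊕-cong ≅-refl (q·-cong ⟦1⟧-⋆))

⟦q[2+2q+q²]⟧-⋆ : {X : GradedSet} →
  (⟦ 0 ∷ 2 ∷ 2 ∷ 1 ∷ [] ⟧ ⋆ X) ≅ ((q· X ⊕ q· X) ⊕ ((q^ 2 · X ⊕ q^ 2 · X) ⊕ q^ 3 · X))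
⟦q[2+2q+q²]⟧-⋆ {X} = begin
  ⟦ 0 ∷ 2 ∷ 2 ∷ 1 ∷ [] ⟧ ⋆ X
    ≈⟨ ≅-trans (⟦0∷⟧-⋆ _) (q·-cong (≅-trans (⟦2∷⟧-⋆ _) (⊕-cong ≅-refl
         (q·-cong (≅-trans (⟦2∷⟧-⋆ _) (⊕-cong ≅-refl (q·-cong ⟦1⟧-⋆))))))) ⟩
  q· ((X ⊕ X) ⊕ q· ((X ⊕ X) ⊕ q· X))
    ≈⟨ q^-⊕ 1 ⟩
  q· (X ⊕ X) ⊕ q^ 2 · ((X ⊕ X) ⊕ q· X)
    ≈⟨ ⊕-cong (q^-⊕ 1) (q^-⊕ 2) ⟩
  (q· X ⊕ q· X) ⊕ (q^ 2 · (X ⊕ X) ⊕ q^ 3 · X)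
    ≈⟨ ⊕-cong ≅-refl (⊕-cong (q^-⊕ 2) ≅-refl) ⟩
  (q· X ⊕ q· X) ⊕ ((q^ 2 · X ⊕ q^ 2 · X) ⊕ q^ 3 · X) ∎
  where open ≅-Reasoning

zeros : (n : ℕ) → Vec ℕ n
zeros n = replicate n 0

unit : ∀ {n} → Fin n → Vec ℕ n
unit {suc n} zero    = 1 ∷ zeros n
unit {suc n} (suc j) = 0 ∷ unit j

infixl 6 _+ᵥ_
_+ᵥ_ : ∀ {n} → Vec ℕ n → Vec ℕ n → Vec ℕ n
_+ᵥ_ = zipWith _+_

vsum-zeros : ∀ n → vsum (zeros n) ≡ 0
vsum-zeros zero    = refl
vsum-zeros (suc n) = vsum-zeros n

vsum-unit : ∀ {n} (j : Fin n) → vsum (unit j) ≡ 1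
vsum-unit {suc n} zero    = cong suc (vsum-zeros n)
vsum-unit {suc n} (suc j) = vsum-unit j

+ᵥ-identityˡ : ∀ {n} (v : Vec ℕ n) → zeros n +ᵥ v ≡ v
+ᵥ-identityˡ []      = refl
+ᵥ-identityˡ (x ∷ v) = cong (x ∷_) (+ᵥ-identityˡ v)

+ᵥ-identityʳ : ∀ {n} (v : Vec ℕ n) → v +ᵥ zeros n ≡ v
+ᵥ-identityʳ []      = refl
+ᵥ-identityʳ (x ∷ v) = cong₂ _∷_ (+-identityʳ x) (+ᵥ-identityʳ v)

+ᵥ-assoc : ∀ {n} (u v w : Vec ℕ n) → (u +ᵥ v) +ᵥ w ≡ u +ᵥ (v +ᵥ w)
+ᵥ-assoc []      []      []      = refl
+ᵥ-assoc (a ∷ u) (b ∷ v) (c ∷ w) = cong₂ _∷_ (+-assoc a b c) (+ᵥ-assoc u v w)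

vsum-+ᵥ : ∀ {n} (u v : Vec ℕ n) → vsum (u +ᵥ v) ≡ vsum u + vsum v
vsum-+ᵥ []      []      = refl
vsum-+ᵥ (a ∷ u) (b ∷ v) = trans (cong (a + b +_) (vsum-+ᵥ u v)) (+-interchange a b (vsum u) (vsum v))

vsum≡0 : ∀ n {P : Vec ℕ n → Set} → Σ (Vec ℕ n) (λ v → (vsum v ≡ 0) × P v) ↔ P (zeros n)
vsum≡0 zero    = mk↔ₛ′ (λ { ([] , refl , p) → p }) (λ p → [] , refl , p)
                       (λ _ → refl) (λ { ([] , refl , p) → refl })
vsum≡0 (suc n) = begin
  _ ↔⟨ ΣVec-split ⟩
  _ ↔⟨ Σℕ-split ⟩
  _ ↔⟨ drop-emptyʳ (Σ-empty λ { x (v , () , _) }) ⟩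
  _ ↔⟨ vsum≡0 n ⟩
  _ ∎
  where open EquationalReasoning

vsum≡1 : ∀ n {P : Vec ℕ n → Set} → Σ (Vec ℕ n) (λ v → (vsum v ≡ 1) × P v) ↔ Σ (Fin n) (P ∘ unit)
vsum≡1 zero    = empty↔empty (λ { ([] , () , _) }) (λ ())
vsum≡1 (suc n) = begin
  _ ↔⟨ ΣVec-split ⟩
  _ ↔⟨ Σℕ-split ⟩
  _ ↔⟨ ⊎-cong (vsum≡1 n) Σℕ-split ⟩
  _ ↔⟨ ⊎-cong ↔-refl (drop-emptyʳ (Σ-empty λ { x (v , () , _) })) ⟩
  _ ↔⟨ ⊎-cong ↔-refl (Σ-congʳ λ v → ×-cong suc≡suc↔ ↔-refl) ⟩
  _ ↔⟨ ⊎-cong ↔-refl (vsum≡0 n) ⟩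
  _ ↔⟨ ⊎-comm _ _ ⟩
  _ ↔⟨ ↔-sym ΣFin-split ⟩
  _ ∎
  where open EquationalReasoning

module _ (r : ℕ) {P : ℕ → Vec ℕ r → Set} where
  private
    P′ : Vec ℕ (suc r) → Set
    P′ (x ∷ v) = P x v

  head+tail≡0 : Σ ℕ (λ v₀ → Σ (Vec ℕ r) λ v → (v₀ + vsum v ≡ 0) × P v₀ v) ↔ P 0 (zeros r)
  head+tail≡0 = ↔-trans (↔-sym (ΣVec-split {F = λ v → (vsum v ≡ 0) × P′ v})) (vsum≡0 (suc r))

  head+tail≡1 : Σ ℕ (λ v₀ → Σ (Vec ℕ r) λ v → (v₀ + vsum v ≡ 1) × P v₀ v) ↔
                (P 1 (zeros r) ⊎ Σ (Fin r) λ j → P 0 (unit j))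
  head+tail≡1 = ↔-trans (↔-sym (ΣVec-split {F = λ v → (vsum v ≡ 1) × P′ v}))
                        (↔-trans (vsum≡1 (suc r)) ΣFin-split)

  head+tail≡2 : Σ ℕ (λ v₀ → Σ (Vec ℕ r) λ v → (v₀ + vsum v ≡ 2) × P v₀ v) ↔
                (Σ (Vec ℕ r) (λ v → (vsum v ≡ 2) × P 0 v) ⊎ (Σ (Fin r) (λ j → P 1 (unit j)) ⊎ P 2 (zeros r)))
  head+tail≡2 = begin
    _ ↔⟨ Σℕ-split ⟩
    _ ↔⟨ ⊎-cong ↔-refl Σℕ-split ⟩
    _ ↔⟨ ⊎-cong ↔-refl (⊎-cong (Σ-congʳ λ v → ×-cong suc≡suc↔ ↔-refl) Σℕ-split) ⟩
    _ ↔⟨ ⊎-cong ↔-refl (⊎-cong (vsum≡1 r) (drop-emptyʳ (Σ-empty λ { x (v , () , _) }))) ⟩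
    _ ↔⟨ ⊎-cong ↔-refl (⊎-cong ↔-refl (Σ-congʳ λ v → ×-cong (↔-trans suc≡suc↔ suc≡suc↔) ↔-refl)) ⟩
    _ ↔⟨ ⊎-cong ↔-refl (⊎-cong ↔-refl (vsum≡0 r)) ⟩
    _ ∎
    where open EquationalReasoning

-- Scanning positions from left to right, a partial decomposition leaves some
-- intervals "open".  `Carried r inc ξ k` is the set of ways to add k positive
-- roots of A_r so that, together with inc m intervals arriving from the left and
-- ending at position m, the coefficients sum to ξ.  At the first position one
-- chooses v₀ copies of [0,0] and v j copies of [0,j+1]; these cost v₀ + vsum v,
-- and the intervals [0,j+1] are carried on to the remaining positions.

Carried : (r : ℕ) → Vec ℕ r → Vec ℕ r → GradedSet
Carried zero    []         []      k = 0 ≡ k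
Carried (suc r) (c₀ ∷ inc) (x ∷ ξ) k =
  Σ ℕ λ v₀ → Σ (Vec ℕ r) λ v →
    (c₀ + vsum inc + (v₀ + vsum v) ≡ x) × (q^ (v₀ + vsum v) · Carried r (inc +ᵥ v) ξ) k

D₀ D₁ D : ∀ {r} → Vec ℕ r → GradedSet
D₀ {r} ξ   = Carried r (zeros r) ξ
D₁ {r} ξ k = Σ (Fin r) λ j → Carried r (unit j) ξ k
D ξ        = D₀ ξ ⊕ D₁ ξ

-- The positive roots of A_(r+1) are the intervals [0,j] followed by the roots of
-- A_r shifted one step to the right.  Splitting a decomposition accordingly and
-- recording the intervals [0,j+1] as carried ones is exactly the recursion of
-- `Carried`.

shift : ∀ {r} → PosRootIdx r → PosRootIdx (suc r)
shift (i , j) = suc i , suc j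

≤ᵇ-suc : ∀ a b → (suc a ≤ᵇ suc b) ≡ (a ≤ᵇ b)
≤ᵇ-suc zero    b = refl
≤ᵇ-suc (suc a) b = refl

member-≤ᵇ : ∀ i m j → isYes ((i ≤? m) ×-dec (m ≤? j)) ≡ (i ≤ᵇ m) ∧ (m ≤ᵇ j)
member-≤ᵇ i m j = isYes≗does ((i ≤? m) ×-dec (m ≤? j))

member-shift : ∀ i m j →
  isYes ((suc i ≤? suc m) ×-dec (suc m ≤? suc j)) ≡ isYes ((i ≤? m) ×-dec (m ≤? j))
member-shift i m j = begin
  isYes ((suc i ≤? suc m) ×-dec (suc m ≤? suc j)) ≡⟨ member-≤ᵇ (suc i) (suc m) (suc j) ⟩
  (suc i ≤ᵇ suc m) ∧ (suc m ≤ᵇ suc j)             ≡⟨ cong₂ _∧_ (≤ᵇ-suc i m) (≤ᵇ-suc m j) ⟩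
  (i ≤ᵇ m) ∧ (m ≤ᵇ j)                             ≡⟨ sym (member-≤ᵇ i m j) ⟩
  isYes ((i ≤? m) ×-dec (m ≤? j))                 ∎
  where open ≡-Reasoning

member-[0,suc] : ∀ m j → isYes ((0 ≤? suc m) ×-dec (suc m ≤? suc j)) ≡ isYes ((0 ≤? m) ×-dec (m ≤? j))
member-[0,suc] m j = trans (member-≤ᵇ 0 (suc m) (suc j)) (trans (≤ᵇ-suc m j) (sym (member-≤ᵇ 0 m j)))

rootVec-shift : ∀ {r} (α : PosRootIdx r) → rootVec (shift α) ≡ 0 ∷ rootVec α
rootVec-shift (i , j) =
  cong (0 ∷_) (tabulate-cong λ m → cong (λ b → if b then 1 else 0) (member-shift (toℕ i) (toℕ m) (toℕ j)))

tabulate-zero : ∀ n → tabulate {n = n} (λ _ → 0) ≡ zeros n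
tabulate-zero zero    = refl
tabulate-zero (suc n) = cong (0 ∷_) (tabulate-zero n)

rootVec-[0,0] : ∀ {r} → rootVec {suc r} (zero , zero) ≡ 1 ∷ zeros r
rootVec-[0,0] {r} = cong (1 ∷_) (tabulate-zero r)

rootVec-[0,suc] : ∀ {r} (j : Fin (suc r)) → rootVec {suc (suc r)} (zero , suc j) ≡ 1 ∷ rootVec (zero , j)
rootVec-[0,suc] j = cong (1 ∷_) (tabulate-cong λ m → cong (λ b → if b then 1 else 0) (member-[0,suc] (toℕ m) (toℕ j)))

ordered? : ∀ {r} → Decidable {A = PosRootIdx r} (λ p → toℕ (proj₁ p) ≤ toℕ (proj₂ p))
ordered? p = toℕ (proj₁ p) ≤? toℕ (proj₂ p)

filter-map : ∀ {X Y : Set} {P : Y → Set} {Q : X → Set} (P? : Decidable P) (Q? : Decidable Q)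
  (f : X → Y) → (∀ x → does (P? (f x)) ≡ does (Q? x)) →
  ∀ xs → filter P? (map f xs) ≡ map f (filter Q? xs)
filter-map P? Q? f h []       = refl
filter-map P? Q? f h (x ∷ xs) with does (P? (f x)) | does (Q? x) | h x
... | true  | true  | refl = cong (f x ∷_) (filter-map P? Q? f h xs)
... | false | false | refl = filter-map P? Q? f h xs

filter-[0,j] : ∀ {r} (js : List (Fin (suc r))) → filter ordered? (map (zero ,_) js) ≡ map (zero ,_) js
filter-[0,j] []       = refl
filter-[0,j] (j ∷ js) = cong (_ ∷_) (filter-[0,j] js)

filter-shifted : ∀ {r} (is js : List (Fin r)) →
  filter ordered? (cartesianProduct (map suc is) (zero ∷ map suc js)) ≡
  map shift (filter ordered? (cartesianProduct is js))
filter-shifted []       js = refl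
filter-shifted (i ∷ is) js = begin
  filter ordered? (map (suc i ,_) (zero ∷ map suc js) ++ rest)
    ≡⟨ filter-++ ordered? (map (suc i ,_) (zero ∷ map suc js)) rest ⟩
  filter ordered? (map (suc i ,_) (map suc js)) ++ filter ordered? rest
    ≡⟨ cong₂ _++_ (cong (filter ordered?) (trans (sym (map-∘ js)) (map-∘ js))) (filter-shifted is js) ⟩
  filter ordered? (map shift (map (i ,_) js)) ++ map shift (filter ordered? (cartesianProduct is js))
    ≡⟨ cong (_++ _) (filter-map ordered? ordered? shift (λ (a , b) → ≤ᵇ-suc (toℕ a) (toℕ b)) (map (i ,_) js)) ⟩
  map shift (filter ordered? (map (i ,_) js)) ++ map shift (filter ordered? (cartesianProduct is js))
    ≡⟨ sym (map-++ shift (filter ordered? (map (i ,_) js)) _) ⟩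
  map shift (filter ordered? (map (i ,_) js) ++ filter ordered? (cartesianProduct is js))
    ≡⟨ cong (map shift) (sym (filter-++ ordered? (map (i ,_) js) _)) ⟩
  map shift (filter ordered? (cartesianProduct (i ∷ is) js)) ∎
  where
  open ≡-Reasoning
  rest = cartesianProduct (map suc is) (zero ∷ map suc js)
posRoots-suc : ∀ r → posRoots (suc r) ≡ List.tabulate (zero ,_) ++ map shift (posRoots r)
posRoots-suc r =
  trans (filter-++ ordered? (map (zero ,_) (allFin (suc r))) _)
  (cong₂ _++_ (trans (filter-[0,j] (allFin (suc r))) (map-tabulate (λ j → j) (zero ,_)))
              (trans (cong (λ is → filter ordered? (cartesianProduct is (zero ∷ is))) suc-allFin)
                     (filter-shifted (allFin r) (allFin r))))
  where
  suc-allFin : List.tabulate {n = r} suc ≡ map suc (allFin r)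
  suc-allFin = sym (map-tabulate (λ j → j) suc)

-- cover inc m: the number of carried intervals that cover position m.
cover : ∀ {n} → Vec ℕ n → Vec ℕ n
cover []        = []
cover (c ∷ inc) = (c + vsum inc) ∷ cover inc

cover-+ᵥ : ∀ {n} (u v : Vec ℕ n) → cover (u +ᵥ v) ≡ cover u +ᵥ cover v
cover-+ᵥ []      []      = refl
cover-+ᵥ (a ∷ u) (b ∷ v) =
  cong₂ _∷_ (trans (cong (a + b +_) (vsum-+ᵥ u v)) (+-interchange a b (vsum u) (vsum v))) (cover-+ᵥ u v)

cover-zeros : ∀ n → cover (zeros n) ≡ zeros n
cover-zeros zero    = refl
cover-zeros (suc n) = cong₂ _∷_ (vsum-zeros n) (cover-zeros n)

glue : ∀ {X : Set} (ρ σ : List X) → Vec ℕ (length ρ) → Vec ℕ (length σ) → Vec ℕ (length (ρ ++ σ))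
glue []      σ []      m = m
glue (_ ∷ ρ) σ (c ∷ n) m = c ∷ glue ρ σ n m

Σ-glue : ∀ {X : Set} (ρ σ : List X) {P : Vec ℕ (length (ρ ++ σ)) → Set} →
         Σ _ P ↔ Σ (Vec ℕ (length ρ)) λ n → Σ (Vec ℕ (length σ)) λ m → P (glue ρ σ n m)
Σ-glue []      σ = mk↔ₛ′ (λ (m , p) → [] , m , p) (λ { ([] , m , p) → m , p })
                         (λ { ([] , m , p) → refl }) (λ { (m , p) → refl })
Σ-glue (_ ∷ ρ) σ = ↔-trans ΣVec-split (↔-trans (Σ-congʳ λ c → Σ-glue ρ σ) (↔-sym ΣVec-split))

combo-glue : ∀ {r} (ρ σ : List (PosRootIdx r)) n m →
             combo (ρ ++ σ) (glue ρ σ n m) ≡ combo ρ n +ᵥ combo σ m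
combo-glue []      σ []      m = sym (+ᵥ-identityˡ _)
combo-glue (α ∷ ρ) σ (c ∷ n) m =
  trans (cong (_ +ᵥ_) (combo-glue ρ σ n m)) (sym (+ᵥ-assoc _ _ _))

vsum-glue : ∀ {X : Set} (ρ σ : List X) n m → vsum (glue ρ σ n m) ≡ vsum n + vsum m
vsum-glue []      σ []      m = refl
vsum-glue (_ ∷ ρ) σ (c ∷ n) m = trans (cong (c +_) (vsum-glue ρ σ n m)) (sym (+-assoc c _ _))

alongMap : ∀ {X Y : Set} (f : X → Y) (ρ : List X) → Vec ℕ (length ρ) → Vec ℕ (length (map f ρ))
alongMap f []      []      = []
alongMap f (_ ∷ ρ) (c ∷ n) = c ∷ alongMap f ρ n

Σ-alongMap : ∀ {X Y : Set} (f : X → Y) (ρ : List X) {P : Vec ℕ (length (map f ρ)) → Set} →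
             Σ _ P ↔ Σ (Vec ℕ (length ρ)) (P ∘ alongMap f ρ)
Σ-alongMap f []      = mk↔ₛ′ (λ { ([] , p) → [] , p }) (λ { ([] , p) → [] , p })
                             (λ { ([] , p) → refl }) (λ { ([] , p) → refl })
Σ-alongMap f (_ ∷ ρ) = ↔-trans ΣVec-split (↔-trans (Σ-congʳ λ c → Σ-alongMap f ρ) (↔-sym ΣVec-split))

vsum-alongMap : ∀ {X Y : Set} (f : X → Y) (ρ : List X) n → vsum (alongMap f ρ n) ≡ vsum n
vsum-alongMap f []      []      = refl
vsum-alongMap f (_ ∷ ρ) (c ∷ n) = cong (c +_) (vsum-alongMap f ρ n)

combo-shift : ∀ {r} (ρ : List (PosRootIdx r)) n → combo (map shift ρ) (alongMap shift ρ n) ≡ 0 ∷ combo ρ n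
combo-shift []      []      = refl
combo-shift (α ∷ ρ) (c ∷ n) =
  trans (cong₂ (λ x y → Vec.map (c *_) x +ᵥ y) (rootVec-shift α) (combo-shift ρ n))
        (cong₂ _∷_ (trans (+-identityʳ (c * 0)) (*-zeroʳ c)) refl)

alongTabulate : ∀ n {X : Set} (f : Fin n → X) → Vec ℕ n → Vec ℕ (length (List.tabulate f))
alongTabulate zero    f []      = []
alongTabulate (suc n) f (c ∷ v) = c ∷ alongTabulate n (f ∘ suc) v

Σ-alongTabulate : ∀ n {X : Set} (f : Fin n → X) {P : Vec ℕ (length (List.tabulate f)) → Set} →
                  Σ _ P ↔ Σ (Vec ℕ n) (P ∘ alongTabulate n f)
Σ-alongTabulate zero    f = mk↔ₛ′ (λ { ([] , p) → [] , p }) (λ { ([] , p) → [] , p })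
                                  (λ { ([] , p) → refl }) (λ { ([] , p) → refl })
Σ-alongTabulate (suc n) f =
  ↔-trans ΣVec-split (↔-trans (Σ-congʳ λ c → Σ-alongTabulate n (f ∘ suc)) (↔-sym ΣVec-split))

vsum-alongTabulate : ∀ n {X : Set} (f : Fin n → X) v → vsum (alongTabulate n f v) ≡ vsum v
vsum-alongTabulate zero    f []      = refl
vsum-alongTabulate (suc n) f (c ∷ v) = cong (c +_) (vsum-alongTabulate n (f ∘ suc) v)

scale-zeros : ∀ c n → Vec.map (c *_) (zeros n) ≡ zeros n
scale-zeros c zero    = refl
scale-zeros c (suc n) = cong₂ _∷_ (*-zeroʳ c) (scale-zeros c n)

combo-extendˡ : ∀ n {m} (f : Fin n → PosRootIdx m) (h : Fin n → PosRootIdx (suc m)) →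
  (∀ j → rootVec (h j) ≡ 1 ∷ rootVec (f j)) → ∀ v →
  combo (List.tabulate h) (alongTabulate n h v) ≡ vsum v ∷ combo (List.tabulate f) (alongTabulate n f v)
combo-extendˡ zero    f h ext []      = refl
combo-extendˡ (suc n) f h ext (c ∷ v) =
  trans (cong₂ (λ x y → Vec.map (c *_) x +ᵥ y) (ext zero) (combo-extendˡ n (f ∘ suc) (h ∘ suc) (ext ∘ suc) v))
        (cong₂ _∷_ (cong (_+ vsum v) (*-identityʳ c)) refl)

combo-[0,j] : ∀ r (v : Vec ℕ (suc r)) →
  combo (List.tabulate {n = suc r} (zero ,_)) (alongTabulate (suc r) (zero ,_) v) ≡ cover v
combo-[0,j] zero    (c ∷ []) =
  trans (cong (λ x → Vec.map (c *_) x +ᵥ zeros 1) (rootVec-[0,0] {0}))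
        (cong (_∷ []) (cong (_+ 0) (*-identityʳ c)))
combo-[0,j] (suc r) (c ∷ v) =
  trans (cong₂ (λ x y → Vec.map (c *_) x +ᵥ y) (rootVec-[0,0] {suc r})
                (combo-extendˡ (suc r) (zero ,_) (λ j → zero , suc j) rootVec-[0,suc] v))
        (cong₂ _∷_ (cong (_+ vsum v) (*-identityʳ c))
                   (trans (cong₂ _+ᵥ_ (scale-zeros c (suc r)) (combo-[0,j] r v)) (+ᵥ-identityˡ (cover v))))

DecompOver : ∀ {r} → List (PosRootIdx r) → Vec ℕ r → Vec ℕ r → GradedSet
DecompOver ρ inc ξ k = Σ (Vec ℕ (length ρ)) λ n → (cover inc +ᵥ combo ρ n ≡ ξ) × (vsum n ≡ k)

DecompOver-suc : ∀ r inc ξ k →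
  DecompOver (posRoots (suc r)) inc ξ k ↔
  Σ (Vec ℕ (suc r)) λ v → Σ (Vec ℕ (length (posRoots r))) λ n →
    (cover inc +ᵥ (cover v +ᵥ (0 ∷ combo (posRoots r) n)) ≡ ξ) × (vsum v + vsum n ≡ k)
DecompOver-suc r inc ξ k = begin
  DecompOver (posRoots (suc r)) inc ξ k
    ↔⟨ ≡⇒↔ (cong (λ ρ → DecompOver ρ inc ξ k) (posRoots-suc r)) ⟩
  DecompOver (T ++ M) inc ξ k
    ↔⟨ Σ-glue T M ⟩
  _ ↔⟨ Σ-congʳ (λ n → Σ-congʳ λ m → ×-cong (≡⇒↔ (cong (λ z → cover inc +ᵥ z ≡ ξ) (combo-glue T M n m)))
                                           (≡⇒↔ (cong (_≡ k) (vsum-glue T M n m)))) ⟩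
  _ ↔⟨ Σ-alongTabulate (suc r) (zero ,_) ⟩
  _ ↔⟨ Σ-congʳ (λ v → Σ-alongMap shift R) ⟩
  _ ↔⟨ Σ-congʳ (λ v → Σ-congʳ λ n →
         ×-cong (≡⇒↔ (cong₂ (λ a b → cover inc +ᵥ (a +ᵥ b) ≡ ξ) (combo-[0,j] r v) (combo-shift R n)))
                (≡⇒↔ (cong₂ (λ a b → a + b ≡ k) (vsum-alongTabulate (suc r) (zero ,_) v) (vsum-alongMap shift R n)))) ⟩
  _ ∎
  where
  open EquationalReasoning
  R : List (PosRootIdx r)
  R = posRoots r
  T M : List (PosRootIdx (suc r))
  T = List.tabulate (zero ,_)
  M = map shift R

balance-split : ∀ {r} c₀ (inc : Vec ℕ r) x ξ v₀ v w →
  (cover (c₀ ∷ inc) +ᵥ (cover (v₀ ∷ v) +ᵥ (0 ∷ w)) ≡ x ∷ ξ) ↔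
  ((c₀ + vsum inc + (v₀ + vsum v) ≡ x) × (cover (inc +ᵥ v) +ᵥ w ≡ ξ))
balance-split c₀ inc x ξ v₀ v w =
  ↔-trans ∷≡∷↔ (×-cong (≡⇒↔ (cong (λ y → c₀ + vsum inc + y ≡ x) (+-identityʳ (v₀ + vsum v))))
                       (≡⇒↔ (cong (_≡ ξ) rest)))
  where
  rest : cover inc +ᵥ (cover v +ᵥ w) ≡ cover (inc +ᵥ v) +ᵥ w
  rest = trans (sym (+ᵥ-assoc (cover inc) (cover v) w)) (cong (_+ᵥ w) (sym (cover-+ᵥ inc v)))

pull-out : {N H : Set} {E W : N → Set} → Σ N (λ n → (H × E n) × W n) ↔ (H × Σ N (λ n → E n × W n))
pull-out = mk↔ₛ′ (λ (n , (h , e) , w) → h , n , e , w) (λ (h , n , e , w) → n , (h , e) , w)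
                 (λ _ → refl) (λ _ → refl)

DecompOver↔Carried : ∀ r inc ξ → DecompOver (posRoots r) inc ξ ≅ Carried r inc ξ
DecompOver↔Carried zero    []         []      k =
  mk↔ₛ′ (λ { ([] , _ , p) → p }) (λ p → [] , refl , p) (λ _ → refl) (λ { ([] , refl , p) → refl })
DecompOver↔Carried (suc r) (c₀ ∷ inc) (x ∷ ξ) k = begin
  _ ↔⟨ DecompOver-suc r (c₀ ∷ inc) (x ∷ ξ) k ⟩
  _ ↔⟨ ΣVec-split ⟩
  _ ↔⟨ Σ-congʳ (λ v₀ → Σ-congʳ λ v → Σ-congʳ λ n →
         ×-cong (balance-split c₀ inc x ξ v₀ v (combo (posRoots r) n)) ↔-refl) ⟩
  _ ↔⟨ Σ-congʳ (λ v₀ → Σ-congʳ λ v → pull-out) ⟩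
  _ ↔⟨ Σ-congʳ (λ v₀ → Σ-congʳ λ v → ×-cong ↔-refl
         (↔-trans (q^-shift (v₀ + vsum v) _ vsum k)
                  (q^-cong (v₀ + vsum v) (DecompOver↔Carried r (inc +ᵥ v) ξ) k))) ⟩
  _ ∎
  where open EquationalReasoning

DecompUsing↔D₀ : ∀ r ξ → DecompUsing r ξ ≅ D₀ ξ
DecompUsing↔D₀ r ξ k =
  ↔-trans (Σ-congʳ λ n → ×-cong (≡⇒↔ (cong (_≡ ξ) (sym no-cover))) ↔-refl)
          (DecompOver↔Carried r (zeros r) ξ k)
  where
  no-cover : ∀ {n} → cover (zeros r) +ᵥ combo (posRoots r) n ≡ combo (posRoots r) n
  no-cover {n} = trans (cong (_+ᵥ combo (posRoots r) n) (cover-zeros r)) (+ᵥ-identityˡ _)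

+-cancelˡ↔ : ∀ c {a b} → (c + a ≡ c + b) ↔ (a ≡ b)
+-cancelˡ↔ zero    = ↔-refl
+-cancelˡ↔ (suc c) = ↔-trans suc≡suc↔ (+-cancelˡ↔ c)

-- If the coefficient at position 0 exceeds the number of carried intervals by s,
-- then exactly s new intervals start at position 0, costing s roots.
Carried-step : ∀ {r} c₀ inc x (ξ : Vec ℕ r) s → c₀ + vsum inc + s ≡ x →
  Carried (suc r) (c₀ ∷ inc) (x ∷ ξ) ≅
  (λ k → Σ ℕ λ v₀ → Σ (Vec ℕ r) λ v → (v₀ + vsum v ≡ s) × (q^ s · Carried r (inc +ᵥ v) ξ) k)
Carried-step {r} c₀ inc x ξ s refl k = Σ-congʳ λ v₀ → Σ-congʳ λ v →
  ↔-trans (×-cong (+-cancelˡ↔ (c₀ + vsum inc)) ↔-refl)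
          (transport× {Q = λ t → (q^ t · Carried r (inc +ᵥ v) ξ) k})

Carried-overfull : ∀ {r} inc x (ξ : Vec ℕ r) → x < vsum inc → ∀ k → ¬ Carried (suc r) inc (x ∷ ξ) k
Carried-overfull (c₀ ∷ inc) x ξ x<c k (v₀ , v , balance , _) =
  <⇒≱ x<c (subst (vsum (c₀ ∷ inc) ≤_) balance (m≤m+n (vsum (c₀ ∷ inc)) (v₀ + vsum v)))

Carried-≡ : ∀ {r inc inc′} (ξ : Vec ℕ r) → inc ≡ inc′ → Carried r inc ξ ≅ Carried r inc′ ξ
Carried-≡ ξ refl = ≅-refl

-- Coefficient 1, nothing carried: exactly one new interval starts here; it ends
-- here (D₀) or is carried on (D₁).
D₀-1∷ : ∀ {r} (ξ : Vec ℕ r) → D₀ (1 ∷ ξ) ≅ q· D ξ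
D₀-1∷ {r} ξ k = begin
  D₀ (1 ∷ ξ) k
    ↔⟨ Carried-step 0 (zeros r) 1 ξ 1 (cong (_+ 1) (vsum-zeros r)) k ⟩
  _ ↔⟨ head+tail≡1 r ⟩
  ((q· Carried r (zeros r +ᵥ zeros r) ξ) k ⊎ Σ (Fin r) λ j → (q· Carried r (zeros r +ᵥ unit j) ξ) k)
    ↔⟨ ⊎-cong (q·-cong (Carried-≡ ξ (+ᵥ-identityˡ _)) k)
              (↔-trans (Σ-congʳ λ j → q·-cong (Carried-≡ ξ (+ᵥ-identityˡ _)) k) (q·-Σ k)) ⟩
  ((q· D₀ ξ) k ⊎ (q· D₁ ξ) k)
    ↔⟨ ↔-sym (q·-⊕ k) ⟩
  (q· D ξ) k ∎
  where open EquationalReasoning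

-- Coefficient 1, one interval carried: no new interval starts here.  The carried
-- interval ends here (D₀) or is carried on (D₁).
D₁-1∷ : ∀ {r} (ξ : Vec ℕ r) → D₁ (1 ∷ ξ) ≅ D ξ
D₁-1∷ {r} ξ k = begin
  D₁ (1 ∷ ξ) k
    ↔⟨ ΣFin-split ⟩
  (Carried (suc r) (1 ∷ zeros r) (1 ∷ ξ) k ⊎ Σ (Fin r) λ j → Carried (suc r) (0 ∷ unit j) (1 ∷ ξ) k)
    ↔⟨ ⊎-cong (Carried-step 1 (zeros r) 1 ξ 0 (cong suc (trans (+-identityʳ _) (vsum-zeros r))) k)
              (Σ-congʳ λ j → Carried-step 0 (unit j) 1 ξ 0 (trans (+-identityʳ _) (vsum-unit j)) k) ⟩
  _ ↔⟨ ⊎-cong (head+tail≡0 r) (Σ-congʳ λ j → head+tail≡0 r) ⟩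
  (Carried r (zeros r +ᵥ zeros r) ξ k ⊎ Σ (Fin r) λ j → Carried r (unit j +ᵥ zeros r) ξ k)
    ↔⟨ ⊎-cong (Carried-≡ ξ (+ᵥ-identityˡ _) k) (Σ-congʳ λ j → Carried-≡ ξ (+ᵥ-identityʳ _) k) ⟩
  D ξ k ∎
  where open EquationalReasoning

-- Coefficients 2,1, nothing carried: two new intervals start at position 0
-- (two intervals reaching position 1 would overfill it), and at most one of them
-- is carried on.
D₀-2∷1∷ : ∀ {r} (ξ : Vec ℕ r) → D₀ (2 ∷ 1 ∷ ξ) ≅ q^ 2 · D (1 ∷ ξ)
D₀-2∷1∷ {r} ξ k = begin
  D₀ (2 ∷ 1 ∷ ξ) k
    ↔⟨ Carried-step 0 (zeros (suc r)) 2 (1 ∷ ξ) 2 (cong (_+ 2) (vsum-zeros (suc r))) k ⟩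
  _ ↔⟨ head+tail≡2 (suc r) ⟩
  _ ↔⟨ drop-emptyˡ (Σ-empty λ v (two , c) → q^-empty 2 (Carried-overfull (zeros (suc r) +ᵥ v) 1 ξ (overfull v two)) k c) ⟩
  (Σ (Fin (suc r)) (λ j → (q^ 2 · C (zeros (suc r) +ᵥ unit j)) k) ⊎ (q^ 2 · C (zeros (suc r) +ᵥ zeros (suc r))) k)
    ↔⟨ ⊎-cong (↔-trans (Σ-congʳ λ j → q^-cong 2 (Carried-≡ (1 ∷ ξ) (+ᵥ-identityˡ (unit j))) k) (q^-Σ 2 k))
              (q^-cong 2 (Carried-≡ (1 ∷ ξ) (+ᵥ-identityˡ (zeros (suc r)))) k) ⟩
  ((q^ 2 · D₁ (1 ∷ ξ)) k ⊎ (q^ 2 · D₀ (1 ∷ ξ)) k)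
    ↔⟨ ⊎-comm _ _ ⟩
  _ ↔⟨ ↔-sym (q^-⊕ 2 k) ⟩
  (q^ 2 · D (1 ∷ ξ)) k ∎
  where
  open EquationalReasoning
  C : Vec ℕ (suc r) → GradedSet
  C inc = Carried (suc r) inc (1 ∷ ξ)
  overfull : ∀ v → vsum v ≡ 2 → 1 < vsum (zeros (suc r) +ᵥ v)
  overfull v two = subst (1 <_) (sym (trans (cong vsum (+ᵥ-identityˡ v)) two)) (s≤s (s≤s z≤n))

-- Coefficients 2,1, one interval carried: one new interval starts at position 0.
-- Either the carried interval ends at 0 and the new one may go on, or the carried
-- interval goes on and the new one must end at 0 (two would overfill position 1).
D₁-2∷1∷ : ∀ {r} (ξ : Vec ℕ r) → D₁ (2 ∷ 1 ∷ ξ) ≅ (q· D₀ (1 ∷ ξ) ⊕ (q· D₁ (1 ∷ ξ) ⊕ q· D₁ (1 ∷ ξ)))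
D₁-2∷1∷ {r} ξ k = begin
  D₁ (2 ∷ 1 ∷ ξ) k
    ↔⟨ ΣFin-split ⟩
  (Carried (suc (suc r)) (1 ∷ zeros (suc r)) (2 ∷ 1 ∷ ξ) k ⊎
   Σ (Fin (suc r)) λ j → Carried (suc (suc r)) (0 ∷ unit j) (2 ∷ 1 ∷ ξ) k)
    ↔⟨ ⊎-cong (Carried-step 1 (zeros (suc r)) 2 (1 ∷ ξ) 1 (cong (λ z → suc (z + 1)) (vsum-zeros (suc r))) k)
              (Σ-congʳ λ j → Carried-step 0 (unit j) 2 (1 ∷ ξ) 1 (cong (_+ 1) (vsum-unit j)) k) ⟩
  _ ↔⟨ ⊎-cong (head+tail≡1 (suc r)) (Σ-congʳ λ j → head+tail≡1 (suc r)) ⟩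
  _ ↔⟨ ⊎-cong ↔-refl (Σ-congʳ λ j → drop-emptyʳ (Σ-empty λ i →
         q^-empty 1 (Carried-overfull (unit j +ᵥ unit i) 1 ξ (overfull j i)) k)) ⟩
  (((q· C (zeros (suc r) +ᵥ zeros (suc r))) k ⊎ Σ (Fin (suc r)) (λ i → (q· C (zeros (suc r) +ᵥ unit i)) k)) ⊎
   Σ (Fin (suc r)) λ j → (q· C (unit j +ᵥ zeros (suc r))) k)
    ↔⟨ ⊎-cong (⊎-cong (q·-cong (Carried-≡ (1 ∷ ξ) (+ᵥ-identityˡ (zeros (suc r)))) k)
                      (↔-trans (Σ-congʳ λ i → q·-cong (Carried-≡ (1 ∷ ξ) (+ᵥ-identityˡ (unit i))) k) (q·-Σ k)))
              (↔-trans (Σ-congʳ λ j → q·-cong (Carried-≡ (1 ∷ ξ) (+ᵥ-identityʳ (unit j))) k) (q·-Σ k)) ⟩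
  (((q· D₀ (1 ∷ ξ)) k ⊎ (q· D₁ (1 ∷ ξ)) k) ⊎ (q· D₁ (1 ∷ ξ)) k)
    ↔⟨ ⊎-assoc 0ℓ _ _ _ ⟩
  (q· D₀ (1 ∷ ξ) ⊕ (q· D₁ (1 ∷ ξ) ⊕ q· D₁ (1 ∷ ξ))) k ∎
  where
  open EquationalReasoning
  C : Vec ℕ (suc r) → GradedSet
  C inc = Carried (suc r) inc (1 ∷ ξ)
  overfull : ∀ j i → 1 < vsum (unit j +ᵥ unit i)
  overfull j i = subst (1 <_) (sym (trans (vsum-+ᵥ (unit j) (unit i)) (cong₂ _+_ (vsum-unit j) (vsum-unit i))))
                       (s≤s (s≤s z≤n))

⊕-shuffle : {X₁ X₂ X₃ X₄ X₅ : GradedSet} →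
  ((X₁ ⊕ X₂) ⊕ (X₃ ⊕ (X₄ ⊕ X₅))) ≅ ((X₄ ⊕ X₅) ⊕ ((X₂ ⊕ X₃) ⊕ X₁))
⊕-shuffle {X₁} {X₂} {X₃} {X₄} {X₅} k = mk↔ₛ′ to from to∘from from∘to
  where
  to : ((X₁ ⊕ X₂) ⊕ (X₃ ⊕ (X₄ ⊕ X₅))) k → ((X₄ ⊕ X₅) ⊕ ((X₂ ⊕ X₃) ⊕ X₁)) k
  to (inj₁ (inj₁ x)) = inj₂ (inj₂ x)
  to (inj₁ (inj₂ x)) = inj₂ (inj₁ (inj₁ x))
  to (inj₂ (inj₁ x)) = inj₂ (inj₁ (inj₂ x))
  to (inj₂ (inj₂ y)) = inj₁ y
  from : ((X₄ ⊕ X₅) ⊕ ((X₂ ⊕ X₃) ⊕ X₁)) k → ((X₁ ⊕ X₂) ⊕ (X₃ ⊕ (X₄ ⊕ X₅))) k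
  from (inj₂ (inj₂ x))        = inj₁ (inj₁ x)
  from (inj₂ (inj₁ (inj₁ x))) = inj₁ (inj₂ x)
  from (inj₂ (inj₁ (inj₂ x))) = inj₂ (inj₁ x)
  from (inj₁ y)               = inj₂ (inj₂ y)
  to∘from : ∀ z → to (from z) ≡ z
  to∘from (inj₂ (inj₂ x))        = refl
  to∘from (inj₂ (inj₁ (inj₁ x))) = refl
  to∘from (inj₂ (inj₁ (inj₂ x))) = refl
  to∘from (inj₁ y)               = refl
  from∘to : ∀ z → from (to z) ≡ z
  from∘to (inj₁ (inj₁ x)) = refl
  from∘to (inj₁ (inj₂ x)) = refl
  from∘to (inj₂ (inj₁ x)) = refl
  from∘to (inj₂ (inj₂ y)) = refl

D-1∷ : ∀ {r} (ξ : Vec ℕ r) → D (1 ∷ ξ) ≅ (⟦ 1 ∷ 1 ∷ [] ⟧ ⋆ D ξ)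
D-1∷ ξ = begin
  D₀ (1 ∷ ξ) ⊕ D₁ (1 ∷ ξ) ≈⟨ ⊕-cong (D₀-1∷ ξ) (D₁-1∷ ξ) ⟩
  q· D ξ ⊕ D ξ             ≈⟨ ⊕-comm ⟩
  D ξ ⊕ q· D ξ             ≈⟨ ≅-sym ⟦1+q⟧-⋆ ⟩
  ⟦ 1 ∷ 1 ∷ [] ⟧ ⋆ D ξ     ∎
  where open ≅-Reasoning

D-2∷1∷ : ∀ {r} (ξ : Vec ℕ r) → D (2 ∷ 1 ∷ ξ) ≅ (⟦ 0 ∷ 2 ∷ 2 ∷ 1 ∷ [] ⟧ ⋆ D ξ)
D-2∷1∷ ξ = begin
  D₀ (2 ∷ 1 ∷ ξ) ⊕ D₁ (2 ∷ 1 ∷ ξ)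
    ≈⟨ ⊕-cong (D₀-2∷1∷ ξ) (D₁-2∷1∷ ξ) ⟩
  q^ 2 · (D₀ (1 ∷ ξ) ⊕ D₁ (1 ∷ ξ)) ⊕ (q· D₀ (1 ∷ ξ) ⊕ (q· D₁ (1 ∷ ξ) ⊕ q· D₁ (1 ∷ ξ)))
    ≈⟨ ⊕-cong (q^-cong 2 (⊕-cong (D₀-1∷ ξ) (D₁-1∷ ξ)))
              (⊕-cong (q·-cong (D₀-1∷ ξ)) (⊕-cong (q·-cong (D₁-1∷ ξ)) (q·-cong (D₁-1∷ ξ)))) ⟩
  q^ 2 · (q· W ⊕ W) ⊕ (q^ 2 · W ⊕ (q· W ⊕ q· W))
    ≈⟨ ⊕-cong (q^-⊕ 2) ≅-refl ⟩
  (q^ 3 · W ⊕ q^ 2 · W) ⊕ (q^ 2 · W ⊕ (q· W ⊕ q· W))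
    ≈⟨ ⊕-shuffle ⟩
  (q· W ⊕ q· W) ⊕ ((q^ 2 · W ⊕ q^ 2 · W) ⊕ q^ 3 · W)
    ≈⟨ ≅-sym ⟦q[2+2q+q²]⟧-⋆ ⟩
  ⟦ 0 ∷ 2 ∷ 2 ∷ 1 ∷ [] ⟧ ⋆ W ∎
  where
  open ≅-Reasoning
  W : GradedSet
  W = D ξ

L Q : Poly
L = 1 ∷ 1 ∷ []
Q = 2 ∷ 2 ∷ 1 ∷ []

-- The Boolean words built from the blocks "false" (coefficient 1) and
-- "true false" (coefficients 2,1).
data Blocks : ∀ {n} → Vec Bool n → Set where
  []    : Blocks []
  one∷_ : ∀ {n} {J : Vec Bool n} → Blocks J → Blocks (false ∷ J)
  two∷_ : ∀ {n} {J : Vec Bool n} → Blocks J → Blocks (true ∷ false ∷ J)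

ones twos : ∀ {n} {J : Vec Bool n} → Blocks J → ℕ
ones []        = 0
ones (one∷ b)  = suc (ones b)
ones (two∷ b)  = ones b
twos []        = 0
twos (one∷ b)  = twos b
twos (two∷ b)  = suc (twos b)

-- Every block "true false" contributes one element of J and two positions.
twos≡∣∣ : ∀ {n} {J : Vec Bool n} (b : Blocks J) → twos b ≡ ∣ J ∣
twos≡∣∣ []       = refl
twos≡∣∣ (one∷ b) = twos≡∣∣ b
twos≡∣∣ (two∷ b) = cong suc (twos≡∣∣ b)

ones+2twos : ∀ {n} {J : Vec Bool n} (b : Blocks J) → ones b + 2 * twos b ≡ n
ones+2twos []       = refl
ones+2twos (one∷ b) = cong suc (ones+2twos b)
ones+2twos (two∷ b) = begin
  ones b + 2 * suc (twos b)         ≡⟨ cong (ones b +_) (*-suc 2 (twos b)) ⟩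
  ones b + (2 + 2 * twos b)         ≡⟨ +-suc (ones b) (suc (2 * twos b)) ⟩
  suc (ones b + suc (2 * twos b))   ≡⟨ cong suc (+-suc (ones b) (2 * twos b)) ⟩
  suc (suc (ones b + 2 * twos b))   ≡⟨ cong (λ z → suc (suc z)) (ones+2twos b) ⟩
  suc (suc _)                       ∎
  where open ≡-Reasoning

blocks : ∀ {n} (J : Vec Bool n) →
  (∀ m → Vec.lookup J m ≡ true → suc (toℕ m) < n) →
  (∀ a b → Vec.lookup J a ≡ true → Vec.lookup J b ≡ true → toℕ b ≢ suc (toℕ a)) → Blocks J
blocks []                 notLast apart = []
blocks (false ∷ J)        notLast apart =
  one∷ blocks J (λ m e → ≤-pred (notLast (suc m) e))
                (λ a b ea eb eq → apart (suc a) (suc b) ea eb (cong suc eq))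
blocks (true ∷ [])        notLast apart with notLast zero refl
... | s≤s ()
blocks (true ∷ true ∷ J)  notLast apart = ⊥-elim (apart zero (suc zero) refl refl refl)
blocks (true ∷ false ∷ J) notLast apart =
  two∷ blocks J (λ m e → ≤-pred (≤-pred (notLast (suc (suc m)) e)))
                (λ a b ea eb eq → apart (suc (suc a)) (suc (suc b)) ea eb (cong (λ z → suc (suc z)) eq))

D-[] : D [] ≅ ⟦ 1 ∷ [] ⟧
D-[] zero    = mk↔ₛ′ (λ { (inj₁ refl) → zero ; (inj₂ (() , _)) }) (λ { zero → inj₁ refl })
                     (λ { zero → refl }) (λ { (inj₁ refl) → refl ; (inj₂ (() , _)) })
D-[] (suc k) = empty↔empty (λ { (inj₁ ()) ; (inj₂ (() , _)) }) (λ ())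

D-blocks : ∀ {n} {J : Vec Bool n} (b : Blocks J) →
  D (betaI J) ≅ (⟦ L ^P ones b ⟧ ⋆ (⟦ qP ^P twos b ⟧ ⋆ ⟦ Q ^P twos b ⟧))
D-blocks [] = ≅-trans D-[] (≅-sym (≅-trans ⟦1⟧-⋆ ⟦1⟧-⋆))
D-blocks {J = false ∷ J} (one∷ b) = begin
  D (1 ∷ betaI J)                                    ≈⟨ D-1∷ (betaI J) ⟩
  ⟦ L ⟧ ⋆ D (betaI J)                                ≈⟨ ⋆-cong (≅-refl {⟦ L ⟧}) (D-blocks b) ⟩
  ⟦ L ⟧ ⋆ (⟦ L ^P ones b ⟧ ⋆ T)                      ≈⟨ ≅-sym (⋆-assoc {⟦ L ⟧}) ⟩
  (⟦ L ⟧ ⋆ ⟦ L ^P ones b ⟧) ⋆ T                      ≈⟨ ⋆-cong (≅-sym (⟦⟧-*P L (L ^P ones b))) (≅-refl {T}) ⟩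
  ⟦ L ^P suc (ones b) ⟧ ⋆ T                          ∎
  where
  open ≅-Reasoning
  T : GradedSet
  T = ⟦ qP ^P twos b ⟧ ⋆ ⟦ Q ^P twos b ⟧
D-blocks {J = true ∷ false ∷ J} (two∷ b) = begin
  D (2 ∷ 1 ∷ betaI J)
    ≈⟨ D-2∷1∷ (betaI J) ⟩
  ⟦ qP *P Q ⟧ ⋆ D (betaI J)
    ≈⟨ ⋆-cong (⟦⟧-*P qP Q) (D-blocks b) ⟩
  (⟦ qP ⟧ ⋆ ⟦ Q ⟧) ⋆ (Lᵃ ⋆ (⟦ qP ^P twos b ⟧ ⋆ ⟦ Q ^P twos b ⟧))
    ≈⟨ ⋆-left-comm {⟦ qP ⟧ ⋆ ⟦ Q ⟧} ⟩
  Lᵃ ⋆ ((⟦ qP ⟧ ⋆ ⟦ Q ⟧) ⋆ (⟦ qP ^P twos b ⟧ ⋆ ⟦ Q ^P twos b ⟧))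
    ≈⟨ ⋆-cong (≅-refl {Lᵃ}) (⋆-interchange {⟦ qP ⟧}) ⟩
  Lᵃ ⋆ ((⟦ qP ⟧ ⋆ ⟦ qP ^P twos b ⟧) ⋆ (⟦ Q ⟧ ⋆ ⟦ Q ^P twos b ⟧))
    ≈⟨ ⋆-cong (≅-refl {Lᵃ}) (⋆-cong (≅-sym (⟦⟧-*P qP (qP ^P twos b))) (≅-sym (⟦⟧-*P Q (Q ^P twos b)))) ⟩
  Lᵃ ⋆ (⟦ qP ^P suc (twos b) ⟧ ⋆ ⟦ Q ^P suc (twos b) ⟧) ∎
  where
  open ≅-Reasoning
  Lᵃ : GradedSet
  Lᵃ = ⟦ L ^P ones b ⟧

ones≡ : ∀ {n} {J : Vec Bool n} (b : Blocks J) → ones b ≡ n ∸ 2 * ∣ J ∣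
ones≡ {n} {J} b = begin
  ones b                            ≡⟨ sym (m+n∸n≡m (ones b) (2 * twos b)) ⟩
  ones b + 2 * twos b ∸ 2 * twos b  ≡⟨ cong₂ _∸_ (ones+2twos b) (cong (2 *_) (twos≡∣∣ b)) ⟩
  n ∸ 2 * ∣ J ∣                     ∎
  where open ≡-Reasoning

⟦target⟧ : ∀ a t →
  ⟦ (qP ^P (t + 1)) *P ((L ^P a) *P (Q ^P t)) ⟧ ≅ q· (⟦ L ^P a ⟧ ⋆ (⟦ qP ^P t ⟧ ⋆ ⟦ Q ^P t ⟧))
⟦target⟧ a t = begin
  ⟦ (qP ^P (t + 1)) *P ((L ^P a) *P (Q ^P t)) ⟧
    ≈⟨ (λ k → ≡⇒↔ (cong (λ e → ⟦ (qP ^P e) *P ((L ^P a) *P (Q ^P t)) ⟧ k) (+-comm t 1))) ⟩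
  ⟦ (qP *P (qP ^P t)) *P ((L ^P a) *P (Q ^P t)) ⟧
    ≈⟨ ⟦⟧-*P (qP *P (qP ^P t)) ((L ^P a) *P (Q ^P t)) ⟩
  ⟦ qP *P (qP ^P t) ⟧ ⋆ ⟦ (L ^P a) *P (Q ^P t) ⟧
    ≈⟨ ⋆-cong (⟦⟧-*P qP (qP ^P t)) (⟦⟧-*P (L ^P a) (Q ^P t)) ⟩
  (⟦ qP ⟧ ⋆ ⟦ qP ^P t ⟧) ⋆ (⟦ L ^P a ⟧ ⋆ ⟦ Q ^P t ⟧)
    ≈⟨ ⋆-assoc {⟦ qP ⟧} ⟩
  ⟦ qP ⟧ ⋆ (⟦ qP ^P t ⟧ ⋆ (⟦ L ^P a ⟧ ⋆ ⟦ Q ^P t ⟧))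
    ≈⟨ ⟦q⟧-⋆ ⟩
  q· (⟦ qP ^P t ⟧ ⋆ (⟦ L ^P a ⟧ ⋆ ⟦ Q ^P t ⟧))
    ≈⟨ q·-cong (⋆-left-comm {⟦ qP ^P t ⟧}) ⟩
  q· (⟦ L ^P a ⟧ ⋆ (⟦ qP ^P t ⟧ ⋆ ⟦ Q ^P t ⟧)) ∎
  where open ≅-Reasoning

≤∸1⇒suc≤ : ∀ {x} n → suc x ≤ n ∸ 1 → suc (suc x) ≤ n
≤∸1⇒suc≤ (suc n) le = s≤s le

tail-blocks : ∀ n (J : Subset n) →
  (∀ m → m ∈ false ∷ J → (1 ≤ toℕ m) × (toℕ m ≤ suc n ∸ 2)) →
  (∀ a b → a ∈ false ∷ J → b ∈ false ∷ J → toℕ b ≢ suc (toℕ a)) → Blocks J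
tail-blocks n J inside apart = blocks J notLast apartJ
  where
  member : ∀ {m} → Vec.lookup J m ≡ true → suc m ∈ false ∷ J
  member {m} e = lookup⇒[]= (suc m) (false ∷ J) e
  notLast : ∀ m → Vec.lookup J m ≡ true → suc (toℕ m) < n
  notLast m e = ≤∸1⇒suc≤ n (proj₂ (inside (suc m) (member e)))
  apartJ : ∀ a b → Vec.lookup J a ≡ true → Vec.lookup J b ≡ true → toℕ b ≢ suc (toℕ a)
  apartJ a b ea eb eq = apart (suc a) (suc b) (member ea) (member eb) (cong suc eq)

-- Proof: the first position is not in I, so β = 1 ∷ β_J with J a block word;
-- the first coefficient contributes the factor q and the blocks of J the rest.
proposition3p1 : (r : ℕ) → 3 ≤ r → (I : Subset r) →
    (∀ m → m ∈ I → (1 ≤ toℕ m) × (toℕ m ≤ r ∸ 2)) →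
    (∀ a b → a ∈ I → b ∈ I → toℕ b ≢ suc (toℕ a)) →
    (k : ℕ) →
      DecompUsing r (betaI I) k ↔
        Fin (coeff ((qP ^P (∣ I ∣ + 1))
                     *P (((1 ∷ 1 ∷ []) ^P (r ∸ 1 ∸ 2 * ∣ I ∣))
                     *P ((2 ∷ 2 ∷ 1 ∷ []) ^P ∣ I ∣))) k)
proposition3p1 (suc n) _ (true ∷ J) inside _ _
  with () ← proj₁ (inside zero (lookup⇒[]= zero (true ∷ J) refl))
proposition3p1 (suc n) _ (false ∷ J) inside apart k = begin
  DecompUsing (suc n) (1 ∷ betaI J) k
    ↔⟨ DecompUsing↔D₀ (suc n) (1 ∷ betaI J) k ⟩
  D₀ (1 ∷ betaI J) k
    ↔⟨ D₀-1∷ (betaI J) k ⟩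
  (q· D (betaI J)) k
    ↔⟨ q·-cong (D-blocks b) k ⟩
  (q· (⟦ L ^P ones b ⟧ ⋆ (⟦ qP ^P twos b ⟧ ⋆ ⟦ Q ^P twos b ⟧))) k
    ↔⟨ ↔-sym (⟦target⟧ (ones b) (twos b) k) ⟩
  ⟦ (qP ^P (twos b + 1)) *P ((L ^P ones b) *P (Q ^P twos b)) ⟧ k
    ↔⟨ ≡⇒↔ (cong₂ (λ a t → ⟦ (qP ^P (t + 1)) *P ((L ^P a) *P (Q ^P t)) ⟧ k) (ones≡ b) (twos≡∣∣ b)) ⟩
  ⟦ (qP ^P (∣ J ∣ + 1)) *P ((L ^P (n ∸ 2 * ∣ J ∣)) *P (Q ^P ∣ J ∣)) ⟧ k ∎
  where
  open EquationalReasoning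
  b : Blocks J
  b = tail-blocks n J inside apart
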